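{- Let $\mathcal{S}=\langle\mathcal{L},\vdash\rangle$ be a logic. If pfECQ3 holds in $\mathcal{S}$, then spECQ holds in $\mathcal{S}$. Conversely, if $\mathcal{L}$ has at least two distinct elements and spECQ holds in $\mathcal{S}$, then pfECQ3 holds in $\mathcal{S}$. Thus, if $\mathcal{L}$ has at least two distinct elements, pfECQ3 and spECQ are equivalent.
   Context: A logic is a pair $\langle\mathcal{L},\vdash\rangle$ with $\mathcal{L}$ a set and $\vdash\,\subseteq\mathcal{P}(\mathcal{L})\times\mathcal{L}$; $C_\vdash(\Gamma)=\{\alpha:\Gamma\vdash\alpha\}$. spECQ: for every $\Gamma\subsetneq\mathcal{L}$ there is $\alpha\in\mathcal{L}$ with $\Gamma\cup\{\alpha\}\subsetneq\mathcal{L}$ and $C_\vdash(\Gamma\cup\{\alpha\})=\mathcal{L}$. pfECQ3: for every $\Gamma\subsetneq\mathcal{L}$ there is $\Delta$ with $\emptyset\neq\Delta\subsetneq\mathcal{L}$, $\Gamma\cup\Delta\subsetneq\mathcal{L}$, and $C_\vdash(\Gamma\cup\Delta')=\mathcal{L}$ for every nonempty $\Delta'\subseteq\Delta$. -}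

module Defs where

open import Level using (0ℓ)
open import Data.Product using (Σ; _×_; ∃; _,_)
open import Relation.Nullary using (¬_)
open import Relation.Binary.PropositionalEquality using (_≡_)
open import Relation.Unary using (Pred; _∪_; ｛_｝; _⊆_; _≐_; Satisfiable; Universal)

-- Subsets of L are predicates (Pred L 0ℓ); since Agda has no set
-- extensionality, we require ⊢ to be a relation on *sets*, i.e. to respect
-- extensional equality (≐) of subsets.
record Logic : Set₁ where
  field
    L    : Set
    _⊢_  : Pred L 0ℓ → L → Set
    ⊢-resp-≐ : ∀ {Γ Δ : Pred L 0ℓ} {α : L} → Γ ≐ Δ → Γ ⊢ α → Δ ⊢ α

module _ (S : Logic) where
  open Logic S

  C : Pred L 0ℓ → Pred L 0ℓ
  C Γ α = Γ ⊢ α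

  -- Γ ⊊ L  (Γ ⊆ L holds trivially; Γ ≠ L)
  Proper : Pred L 0ℓ → Set
  Proper Γ = ¬ Universal Γ

  Trivializes : Pred L 0ℓ → Set
  Trivializes Γ = Universal (C Γ)

  spECQ : Set₁
  spECQ = ∀ (Γ : Pred L 0ℓ) → Proper Γ →
          Σ L λ α → Proper (Γ ∪ ｛ α ｝) × Trivializes (Γ ∪ ｛ α ｝)

  pfECQ3 : Set₁
  pfECQ3 = ∀ (Γ : Pred L 0ℓ) → Proper Γ →
           Σ (Pred L 0ℓ) λ Δ →
             Satisfiable Δ × Proper Δ × Proper (Γ ∪ Δ) ×
             (∀ (Δ′ : Pred L 0ℓ) → Satisfiable Δ′ → Δ′ ⊆ Δ → Trivializes (Γ ∪ Δ′))

HasTwoDistinct : Logic → Set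
HasTwoDistinct S = ∃ λ (a : Logic.L S) → ∃ λ b → ¬ (a ≡ b)

{-# OPTIONS --safe #-}
-- For pfECQ3 ⇒ spECQ, any point δ of the witness Δ works: {δ} is a
-- nonempty subset of Δ, and Γ ∪ {δ} ⊆ Γ ∪ Δ stays proper. Conversely the
-- singleton {α} supplied by spECQ serves as Δ: its only nonempty subset is
-- itself, and it is a proper subset of L once L has two distinct elements.
module Submission where

open import Defs
open import Data.Product using (_×_; _,_)
open import Data.Sum using (inj₁; inj₂)
open import Level using (0ℓ)
open import Relation.Nullary using (¬_)
open import Relation.Unary using (Pred; _∪_; ｛_｝; _⊆_; _≐_; Satisfiable; Universal)
open import Relation.Unary.Properties using (≐-sym)
open import Function.Bundles using (_⇔_; mk⇔)
open import Relation.Binary.PropositionalEquality using (_≡_; refl; sym; trans; subst)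

module _ {A : Set} where

  ∪-monoʳ-⊆ : (Γ : Pred A 0ℓ) {Δ Δ′ : Pred A 0ℓ} → Δ ⊆ Δ′ → Γ ∪ Δ ⊆ Γ ∪ Δ′
  ∪-monoʳ-⊆ Γ Δ⊆Δ′ (inj₁ x∈Γ) = inj₁ x∈Γ
  ∪-monoʳ-⊆ Γ Δ⊆Δ′ (inj₂ x∈Δ) = inj₂ (Δ⊆Δ′ x∈Δ)

  ∪-congʳ-≐ : (Γ : Pred A 0ℓ) {Δ Δ′ : Pred A 0ℓ} → Δ ≐ Δ′ → Γ ∪ Δ ≐ Γ ∪ Δ′
  ∪-congʳ-≐ Γ {Δ} {Δ′} (Δ⊆Δ′ , Δ′⊆Δ) =
    ∪-monoʳ-⊆ Γ {Δ} {Δ′} Δ⊆Δ′ , ∪-monoʳ-⊆ Γ {Δ′} {Δ} Δ′⊆Δ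

  ∈⇒｛｝⊆ : {Δ : Pred A 0ℓ} {x : A} → Δ x → ｛ x ｝ ⊆ Δ
  ∈⇒｛｝⊆ x∈Δ refl = x∈Δ

  ¬Universal-mono : {P Q : Pred A 0ℓ} → P ⊆ Q → ¬ Universal Q → ¬ Universal P
  ¬Universal-mono P⊆Q ¬ΠQ ΠP = ¬ΠQ (λ x → P⊆Q (ΠP x))

  ｛｝-¬Universal : {a b : A} → ¬ a ≡ b → (x : A) → ¬ Universal ｛ x ｝
  ｛｝-¬Universal {a} {b} a≢b x Π = a≢b (trans (sym (Π a)) (Π b))

  ⊆｛｝⇒≐ : {Δ : Pred A 0ℓ} {x : A} → Satisfiable Δ → Δ ⊆ ｛ x ｝ → Δ ≐ ｛ x ｝
  ⊆｛｝⇒≐ {Δ} (y , y∈Δ) Δ⊆｛x｝ =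
    Δ⊆｛x｝ , λ x≡z → subst Δ (trans (sym (Δ⊆｛x｝ y∈Δ)) x≡z) y∈Δ

module _ (S : Logic) where
  open Logic S

  Trivializes-resp-≐ : {Γ Δ : Pred L 0ℓ} → Γ ≐ Δ → Trivializes S Γ → Trivializes S Δ
  Trivializes-resp-≐ Γ≐Δ triv α = ⊢-resp-≐ Γ≐Δ (triv α)

  pfECQ3⇒spECQ : pfECQ3 S → spECQ S
  pfECQ3⇒spECQ pf Γ Γ-proper with pf Γ Γ-proper
  ... | Δ , (δ , δ∈Δ) , _ , ΓΔ-proper , triv =
    δ , ¬Universal-mono (∪-monoʳ-⊆ Γ {Δ = ｛ δ ｝} (∈⇒｛｝⊆ δ∈Δ)) ΓΔ-proper ,
    triv ｛ δ ｝ (δ , refl) (∈⇒｛｝⊆ δ∈Δ)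

  spECQ⇒pfECQ3 : HasTwoDistinct S → spECQ S → pfECQ3 S
  spECQ⇒pfECQ3 (a , b , a≢b) sp Γ Γ-proper with sp Γ Γ-proper
  ... | α , Γα-proper , triv =
    ｛ α ｝ , (α , refl) , ｛｝-¬Universal a≢b α , Γα-proper ,
    λ Δ′ Δ′-nonempty Δ′⊆｛α｝ →
      Trivializes-resp-≐ (∪-congʳ-≐ Γ (≐-sym (⊆｛｝⇒≐ Δ′-nonempty Δ′⊆｛α｝))) triv

theorem3p17 : (S : Logic) →
    (pfECQ3 S → spECQ S) × (HasTwoDistinct S → spECQ S → pfECQ3 S) ×
    (HasTwoDistinct S → (pfECQ3 S ⇔ spECQ S))
theorem3p17 S =
  pfECQ3⇒spECQ S , spECQ⇒pfECQ3 S ,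
  λ two → mk⇔ (pfECQ3⇒spECQ S) (spECQ⇒pfECQ3 S two)
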